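{- Let $p$ be a prime, let $n\ge 1$, and let $M$ be a matrix over $\mathbb{F}_p$ with $n$ columns, none of which is the zero column (i.e. $M\in\mathcal{M}_n^*$). Let $\vec v$ be a nonzero vector in the row space of $M$. If $\|\vec v\|<n$ and $$p\,\lambda_p(n-\|\vec v\|) > \|\vec v\|,$$ then there is a nonzero vector $\vec z$ in the row space of $M$ such that $\|\vec z\|>\|\vec v\|$.
   Context: For $\vec v=(v_1,\dots,v_n)\in\mathbb{F}_p^n$, $\mathrm{supp}(\vec v)=\{i\in\{1,\dots,n\}: v_i\ne 0\}$ and $\|\vec v\|=|\mathrm{supp}(\vec v)|$. The row space $\mathrm{row}(M)$ of a matrix $M$ over $\mathbb{F}_p$ is the set of all $\mathbb{F}_p$-linear combinations of its rows. The capacity of $M$ is $c(M)=\max_{\vec v\in \mathrm{row}(M)}\|\vec v\|$. For $n\ge1$, $\mathcal{M}_n^*$ is the set of $m\times n$ matrices over $\mathbb{F}_p$ with $1\le m\le p^n$ and no column equal to $\vec 0$, and $\lambda_p(n)=\min_{M\in\mathcal{M}_n^*} c(M)$ (defined for positive integers $n$). -}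

module Defs where

open import Data.Nat using (ℕ; zero; suc; _+_; _*_; _^_; _≤_; _<_; NonZero)
open import Data.Nat.DivMod using (_mod_)
open import Data.Fin using (Fin; toℕ)
import Data.Fin as F
open import Data.Product using (Σ; ∃; _×_; _,_)
open import Relation.Binary.PropositionalEquality using (_≡_; _≢_)

-- Elements of F_p are represented by Fin p (residues 0..p-1); a vector in F_p^n
-- is a function Fin n → Fin p, an m×n matrix is Fin m → Fin n → Fin p.
Vec𝔽 : ℕ → ℕ → Set
Vec𝔽 p n = Fin n → Fin p

Mat𝔽 : ℕ → ℕ → ℕ → Set
Mat𝔽 p m n = Fin m → Fin n → Fin p

sumFin : (m : ℕ) → (Fin m → ℕ) → ℕ
sumFin zero    f = 0
sumFin (suc m) f = f F.zero + sumFin m (λ i → f (F.suc i))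

weight : {p n : ℕ} → Vec𝔽 p n → ℕ
weight {n = zero}  v = 0
weight {n = suc n} v with toℕ (v F.zero)
... | zero  = weight (λ j → v (F.suc j))
... | suc _ = suc (weight (λ j → v (F.suc j)))

InRow : {p m n : ℕ} .{{_ : NonZero p}} → Mat𝔽 p m n → Vec𝔽 p n → Set
InRow {p} {m} M v =
  Σ (Fin m → Fin p) λ a →
    ∀ j → v j ≡ (sumFin m (λ i → toℕ (a i) * toℕ (M i j))) mod p

IsCapacity : {p m n : ℕ} .{{_ : NonZero p}} → Mat𝔽 p m n → ℕ → Set
IsCapacity {p} {m} {n} M c =
  (Σ (Vec𝔽 p n) λ v → InRow M v × weight v ≡ c)
  × (∀ (v : Vec𝔽 p n) → InRow M v → weight v ≤ c)

InMStar : {p m n : ℕ} → Mat𝔽 p m n → Set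
InMStar {p} {m} {n} M =
  (1 ≤ m) × (m ≤ p ^ n) × (∀ (j : Fin n) → Σ (Fin m) λ i → toℕ (M i j) ≢ 0)

IsLambda : (p : ℕ) .{{_ : NonZero p}} → ℕ → ℕ → Set
IsLambda p n l =
  (Σ ℕ λ m → Σ (Mat𝔽 p m n) λ M → InMStar M × IsCapacity M l)
  × (∀ (m : ℕ) (M : Mat𝔽 p m n) → InMStar M → ∀ c → IsCapacity M c → l ≤ c)

-- Let k = ‖v‖ and let σ enumerate the N = n − k coordinates where v vanishes. Picking, for each
-- column σ s, a row of M that is nonzero there gives an N × N matrix in M*_N; hence some w ∈ row(M)
-- has at least λ_p(N) nonzero entries in the columns σ. Every vector t·v + w (t ∈ F_p) of the line
-- through w agrees with w on those columns, while on supp v a given coordinate of t·v + w vanishes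
-- for at most one t. So the line has at most k < p·λ_p(N) zeros on supp v in total, some t has fewer
-- than λ_p(N) of them, and then ‖t·v + w‖ > k.
module Submission where

open import Defs
open import Data.Fin using (Fin; toℕ) renaming (zero to fzero; suc to fsuc)
open import Data.Fin.Properties using (toℕ-injective; toℕ<n; toℕ-fromℕ<) renaming (suc-injective to fsuc-injective)
open import Data.Nat using (ℕ; zero; suc; _+_; _*_; _∸_; _^_; _≤_; _<_; _%_; _<?_; z≤n; s≤s; NonZero; >-nonZero; nonTrivial⇒n>1)
open import Data.Nat.Properties
open import Algebra.Properties.Semiring.Sum +-*-semiring
  using (sum; sum-syntax; sum-cong-≗; sum-replicate-zero; ∑-distrib-+; ∑-comm; *-distribˡ-sum; *-distribʳ-sum)
open import Data.Nat.DivMod using (_mod_; %-distribˡ-+; %-distribˡ-*; m%n%n≡m%n; m%n<n; m<n⇒m%n≡m)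
open import Data.Nat.Divisibility using (_∣_; ∣m+n∣m⇒∣n; >⇒∤; m%n≡0⇒n∣m)
open import Data.Nat.Primality using (Prime; euclidsLemma; prime⇒nonTrivial)
open import Data.Nat.Solver using (module +-*-Solver)
open import Data.Product using (Σ; ∃; _×_; _,_; proj₁; proj₂)
open import Data.Sum using (inj₁; inj₂)
open import Data.Vec.Functional using (_∷_; head; tail)
open import Function using (_∘_)
open import Relation.Binary.PropositionalEquality
open import Relation.Nullary using (yes; no; contradiction)

open +-*-Solver using (solve; _:+_; _:*_; _:=_)

χ≡0 χ≢0 : ℕ → ℕ
χ≡0 zero    = 1
χ≡0 (suc _) = 0
χ≢0 zero    = 0
χ≢0 (suc _) = 1

sumFin≡sum : ∀ m (f : Fin m → ℕ) → sumFin m f ≡ sum f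
sumFin≡sum zero    f = refl
sumFin≡sum (suc m) f = cong (f fzero +_) (sumFin≡sum m (f ∘ fsuc))

sum-mono-≤ : ∀ {m} {f g : Fin m → ℕ} → (∀ i → f i ≤ g i) → sum f ≤ sum g
sum-mono-≤ {zero}  f≤g = z≤n
sum-mono-≤ {suc m} f≤g = +-mono-≤ (f≤g fzero) (sum-mono-≤ (f≤g ∘ fsuc))

sum-const : ∀ m c → ∑[ i < m ] c ≡ m * c
sum-const zero    c = refl
sum-const (suc m) c = cong (c +_) (sum-const m c)

δ : ∀ {m} → Fin m → Fin m → ℕ
δ fzero    fzero    = 1
δ fzero    (fsuc _) = 0
δ (fsuc _) fzero    = 0
δ (fsuc i) (fsuc j) = δ i j

∑-δ : ∀ {m} (i₀ : Fin m) (x : Fin m → ℕ) → ∑[ i < m ] (δ i₀ i * x i) ≡ x i₀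
∑-δ {suc m} fzero    x = begin
  x fzero + 0 + ∑[ i < m ] 0 ≡⟨ cong₂ _+_ (+-identityʳ (x fzero)) (sum-replicate-zero m) ⟩
  x fzero + 0                ≡⟨ +-identityʳ (x fzero) ⟩
  x fzero                    ∎
  where open ≡-Reasoning
∑-δ {suc m} (fsuc i₀) x = ∑-δ i₀ (x ∘ fsuc)

∑<*⇒∃< : ∀ {q} (f : Fin q → ℕ) l → sum f < q * l → ∃ λ t → f t < l
∑<*⇒∃< {suc q} f l ∑f<ql with f fzero <? l
... | yes f₀<l = fzero , f₀<l
... | no  f₀≮l with ∑<*⇒∃< (f ∘ fsuc) l (+-cancelˡ-< l _ _ (≤-<-trans (+-monoˡ-≤ _ (≮⇒≥ f₀≮l)) ∑f<ql))
...   | t , ft<l = fsuc t , ft<l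

supportSize zeroCount : ∀ {n} → (Fin n → ℕ) → ℕ
supportSize u = sum (χ≢0 ∘ u)
zeroCount   u = sum (χ≡0 ∘ u)

zerosOnSupport : ∀ {n} → (Fin n → ℕ) → (Fin n → ℕ) → ℕ
zerosOnSupport x y = sum (λ j → χ≢0 (x j) * χ≡0 (y j))

zeroIndex : ∀ {n} (u : Fin n → ℕ) → Fin (zeroCount u) → Fin n
zeroIndex {suc n} u r with u fzero
zeroIndex {suc n} u fzero    | zero  = fzero
zeroIndex {suc n} u (fsuc r) | zero  = fsuc (zeroIndex (tail u) r)
zeroIndex {suc n} u r        | suc _ = fsuc (zeroIndex (tail u) r)

zeroIndex-zero : ∀ {n} (u : Fin n → ℕ) r → u (zeroIndex u r) ≡ 0
zeroIndex-zero {suc n} u r with u fzero in u₀≡0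
zeroIndex-zero {suc n} u fzero    | zero  = u₀≡0
zeroIndex-zero {suc n} u (fsuc r) | zero  = zeroIndex-zero (tail u) r
zeroIndex-zero {suc n} u r        | suc _ = zeroIndex-zero (tail u) r

∑-zeroIndex : ∀ {n} (u f : Fin n → ℕ) → ∑[ j < n ] (χ≡0 (u j) * f j) ≡ ∑[ r < zeroCount u ] f (zeroIndex u r)
∑-zeroIndex {zero}  u f = refl
∑-zeroIndex {suc n} u f with u fzero
... | zero  = cong₂ _+_ (+-identityʳ (f fzero)) (∑-zeroIndex (tail u) (tail f))
... | suc _ = ∑-zeroIndex (tail u) (tail f)

zeroCount+supportSize : ∀ {n} (u : Fin n → ℕ) → zeroCount u + supportSize u ≡ n
zeroCount+supportSize {n} u = begin
  zeroCount u + supportSize u        ≡⟨ ∑-distrib-+ (χ≡0 ∘ u) (χ≢0 ∘ u) ⟨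
  ∑[ j < n ] (χ≡0 (u j) + χ≢0 (u j)) ≡⟨ sum-cong-≗ (χ≡0+χ≢0 ∘ u) ⟩
  ∑[ j < n ] 1                       ≡⟨ sum-const n 1 ⟩
  n * 1                              ≡⟨ *-identityʳ n ⟩
  n                                  ∎
  where
    open ≡-Reasoning
    χ≡0+χ≢0 : ∀ x → χ≡0 x + χ≢0 x ≡ 1
    χ≡0+χ≢0 zero    = refl
    χ≡0+χ≢0 (suc _) = refl

supportSize-split : ∀ {n} (x y : Fin n → ℕ) →
  supportSize y + zerosOnSupport x y ≡ supportSize x + supportSize (y ∘ zeroIndex x)
supportSize-split {n} x y = begin
  supportSize y + zerosOnSupport x y                         ≡⟨ ∑-distrib-+ (χ≢0 ∘ y) (λ j → χ≢0 (x j) * χ≡0 (y j)) ⟨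
  ∑[ j < n ] (χ≢0 (y j) + χ≢0 (x j) * χ≡0 (y j))            ≡⟨ sum-cong-≗ (λ j → pointwise (x j) (y j)) ⟩
  ∑[ j < n ] (χ≢0 (x j) + χ≡0 (x j) * χ≢0 (y j))            ≡⟨ ∑-distrib-+ (χ≢0 ∘ x) (λ j → χ≡0 (x j) * χ≢0 (y j)) ⟩
  supportSize x + ∑[ j < n ] (χ≡0 (x j) * χ≢0 (y j))         ≡⟨ cong (supportSize x +_) (∑-zeroIndex x (χ≢0 ∘ y)) ⟩
  supportSize x + supportSize (y ∘ zeroIndex x)              ∎
  where
    open ≡-Reasoning
    pointwise : ∀ a b → χ≢0 b + χ≢0 a * χ≡0 b ≡ χ≢0 a + χ≡0 a * χ≢0 b
    pointwise zero    zero    = refl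
    pointwise zero    (suc _) = refl
    pointwise (suc _) zero    = refl
    pointwise (suc _) (suc _) = refl

∑χ≡0≤1 : ∀ {q} (g : Fin q → ℕ) → (∀ t t′ → g t ≡ 0 → g t′ ≡ 0 → t ≡ t′) → sum (χ≡0 ∘ g) ≤ 1
∑χ≡0≤1 {zero}  g unique = z≤n
∑χ≡0≤1 {suc q} g unique with g fzero in g₀≡0
... | zero  = ≤-reflexive (cong suc (trans (sum-cong-≗ tail-nonzero) (sum-replicate-zero q)))
  where
    tail-nonzero : ∀ t → χ≡0 (g (fsuc t)) ≡ 0
    tail-nonzero t with g (fsuc t) in gₜ≡0
    ... | zero  with () ← unique fzero (fsuc t) g₀≡0 gₜ≡0
    ... | suc _ = refl
... | suc _ = ∑χ≡0≤1 (tail g) (λ t t′ e e′ → fsuc-injective (unique (fsuc t) (fsuc t′) e e′))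

∑-zerosOnSupport≤supportSize : ∀ {q n} (x : Fin n → ℕ) (y : Fin q → Fin n → ℕ) →
  (∀ j → 0 < x j → ∀ t t′ → y t j ≡ 0 → y t′ j ≡ 0 → t ≡ t′) →
  ∑[ t < q ] zerosOnSupport x (y t) ≤ supportSize x
∑-zerosOnSupport≤supportSize {q} {n} x y unique = begin
  ∑[ t < q ] ∑[ j < n ] (χ≢0 (x j) * χ≡0 (y t j)) ≡⟨ ∑-comm (λ t j → χ≢0 (x j) * χ≡0 (y t j)) ⟩
  ∑[ j < n ] ∑[ t < q ] (χ≢0 (x j) * χ≡0 (y t j)) ≤⟨ sum-mono-≤ column ⟩
  supportSize x                                     ∎
  where
    open ≤-Reasoning
    column : ∀ j → ∑[ t < q ] (χ≢0 (x j) * χ≡0 (y t j)) ≤ χ≢0 (x j)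
    column j with x j in xⱼ
    ... | zero  = ≤-reflexive (sum-replicate-zero q)
    ... | suc _ = ≤-trans (≤-reflexive (sum-cong-≗ (λ t → +-identityʳ (χ≡0 (y t j)))))
                          (∑χ≡0≤1 (λ t → y t j) (unique j (subst (0 <_) (sym xⱼ) (s≤s z≤n))))

argmax-Fin : ∀ {q} .{{_ : NonZero q}} (g : Fin q → ℕ) → ∃ λ x → ∀ y → g y ≤ g x
argmax-Fin {suc zero}    g = fzero , λ { fzero → ≤-refl }
argmax-Fin {suc (suc q)} g with argmax-Fin (tail g)
... | x , tail-g≤ with g fzero ≤? g (fsuc x)
...   | yes g₀≤ = fsuc x , λ { fzero → g₀≤ ; (fsuc y) → tail-g≤ y }
...   | no  g₀≰ = fzero  , λ { fzero → ≤-refl ; (fsuc y) → ≤-trans (tail-g≤ y) (≰⇒≥ g₀≰) }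

argmax-→ : ∀ {q} .{{_ : NonZero q}} r (f : (Fin r → Fin q) → ℕ) →
  (∀ {a b} → (∀ i → a i ≡ b i) → f a ≡ f b) → ∃ λ a → ∀ b → f b ≤ f a
argmax-→ zero    f f-cong = (λ ()) , λ b → ≤-reflexive (f-cong (λ ()))
argmax-→ (suc r) f f-cong = x* ∷ proj₁ (best x*) , bound
  where
    best : ∀ x → ∃ λ a → ∀ b → f (x ∷ b) ≤ f (x ∷ a)
    best x = argmax-→ r (λ a → f (x ∷ a)) (λ a≗b → f-cong λ { fzero → refl ; (fsuc i) → a≗b i })
    x*     = argmax-Fin (λ x → f (x ∷ proj₁ (best x))) .proj₁
    bound : ∀ b → f b ≤ f (x* ∷ proj₁ (best x*))
    bound b = begin
      f b                                 ≡⟨ f-cong (λ { fzero → refl ; (fsuc i) → refl }) ⟩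
      f (head b ∷ tail b)                 ≤⟨ proj₂ (best (head b)) (tail b) ⟩
      f (head b ∷ proj₁ (best (head b)))  ≤⟨ argmax-Fin (λ x → f (x ∷ proj₁ (best x))) .proj₂ (head b) ⟩
      f (x* ∷ proj₁ (best x*))            ∎
      where open ≤-Reasoning

n<m^n : ∀ {m} → 1 < m → ∀ n → n < m ^ n
n<m^n         1<m zero    = s≤s z≤n
n<m^n {m@(suc _)} 1<m (suc n) = begin-strict
  suc n      ≤⟨ n<m^n 1<m n ⟩
  m ^ n      ≡⟨ *-identityˡ (m ^ n) ⟨
  1 * m ^ n  <⟨ *-monoˡ-< (m ^ n) {{m^n≢0 m n}} 1<m ⟩
  m * m ^ n  ∎
  where open ≤-Reasoning

∣∧<⇒≡0 : ∀ {p d} → p ∣ d → d < p → d ≡ 0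
∣∧<⇒≡0 {d = zero}  _   _   = refl
∣∧<⇒≡0 {d = suc _} p∣d d<p = contradiction p∣d (>⇒∤ d<p)

affine-root-unique-≤ : ∀ {p x w s s′} → Prime p → 0 < x → x < p → s ≤ s′ → s′ < p →
  p ∣ s * x + w → p ∣ s′ * x + w → s ≡ s′
affine-root-unique-≤ {p} {x} {w} {s} {s′} p-prime 0<x x<p s≤s′ s′<p p∣sx+w p∣s′x+w =
  ≤-antisym s≤s′ (m∸n≡0⇒m≤n d≡0)
  where
    d = s′ ∸ s
    s′x+w≡ : s′ * x + w ≡ (s * x + w) + d * x
    s′x+w≡ = begin
      s′ * x + w            ≡⟨ cong (λ y → y * x + w) (m+[n∸m]≡n s≤s′) ⟨
      (s + d) * x + w       ≡⟨ solve 4 (λ s d x w → (s :+ d) :* x :+ w := (s :* x :+ w) :+ d :* x) refl s d x w ⟩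
      (s * x + w) + d * x   ∎
      where open ≡-Reasoning
    d≡0 : d ≡ 0
    d≡0 with euclidsLemma d x p-prime (∣m+n∣m⇒∣n (subst (p ∣_) s′x+w≡ p∣s′x+w) p∣sx+w)
    ... | inj₁ p∣d = ∣∧<⇒≡0 p∣d (≤-<-trans (m∸n≤m s′ s) s′<p)
    ... | inj₂ p∣x = contradiction p∣x (>⇒∤ {{>-nonZero 0<x}} x<p)

affine-root-unique : ∀ {p x w} → Prime p → 0 < x → x < p → (s s′ : Fin p) →
  p ∣ toℕ s * x + w → p ∣ toℕ s′ * x + w → s ≡ s′
affine-root-unique p-prime 0<x x<p s s′ p∣s p∣s′ with ≤-total (toℕ s) (toℕ s′)
... | inj₁ s≤s′ = toℕ-injective (affine-root-unique-≤ p-prime 0<x x<p s≤s′ (toℕ<n s′) p∣s p∣s′)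
... | inj₂ s′≤s = sym (toℕ-injective (affine-root-unique-≤ p-prime 0<x x<p s′≤s (toℕ<n s) p∣s′ p∣s))

combination : ∀ {p m n} → Mat𝔽 p m n → (Fin m → ℕ) → Fin n → ℕ
combination {m = m} M x j = ∑[ i < m ] (x i * toℕ (M i j))

combination-linear : ∀ {p m n} (M : Mat𝔽 p m n) t (x y : Fin m → ℕ) j →
  combination M (λ i → t * x i + y i) j ≡ t * combination M x j + combination M y j
combination-linear {m = m} M t x y j = begin
  ∑[ i < m ] ((t * x i + y i) * Mᵢⱼ i)                 ≡⟨ sum-cong-≗ (λ i → trans (*-distribʳ-+ (Mᵢⱼ i) (t * x i) (y i))
                                                                              (cong (_+ y i * Mᵢⱼ i) (*-assoc t (x i) (Mᵢⱼ i)))) ⟩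
  ∑[ i < m ] (t * (x i * Mᵢⱼ i) + y i * Mᵢⱼ i)         ≡⟨ ∑-distrib-+ (λ i → t * (x i * Mᵢⱼ i)) (λ i → y i * Mᵢⱼ i) ⟩
  ∑[ i < m ] (t * (x i * Mᵢⱼ i)) + combination M y j   ≡⟨ cong (_+ combination M y j) (*-distribˡ-sum t (λ i → x i * Mᵢⱼ i)) ⟨
  t * combination M x j + combination M y j            ∎
  where
    open ≡-Reasoning
    Mᵢⱼ = λ i → toℕ (M i j)

combination-selectRows : ∀ {p k m n} (M : Mat𝔽 p m n) (ρ : Fin k → Fin m) (y : Fin k → ℕ) j →
  combination (M ∘ ρ) y j ≡ combination M (λ i → ∑[ r < k ] (y r * δ (ρ r) i)) j
combination-selectRows {k = k} {m} M ρ y j = sym (begin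
  ∑[ i < m ] (∑[ r < k ] (y r * δ (ρ r) i) * Mᵢⱼ i)   ≡⟨ sum-cong-≗ (λ i → *-distribʳ-sum (Mᵢⱼ i) (λ r → y r * δ (ρ r) i)) ⟩
  ∑[ i < m ] ∑[ r < k ] (y r * δ (ρ r) i * Mᵢⱼ i)     ≡⟨ ∑-comm (λ i r → y r * δ (ρ r) i * Mᵢⱼ i) ⟩
  ∑[ r < k ] ∑[ i < m ] (y r * δ (ρ r) i * Mᵢⱼ i)     ≡⟨ sum-cong-≗ (λ r → sum-cong-≗ (λ i → *-assoc (y r) (δ (ρ r) i) (Mᵢⱼ i))) ⟩
  ∑[ r < k ] ∑[ i < m ] (y r * (δ (ρ r) i * Mᵢⱼ i))   ≡⟨ sum-cong-≗ (λ r → *-distribˡ-sum (y r) (λ i → δ (ρ r) i * Mᵢⱼ i)) ⟨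
  ∑[ r < k ] (y r * ∑[ i < m ] (δ (ρ r) i * Mᵢⱼ i))   ≡⟨ sum-cong-≗ (λ r → cong (y r *_) (∑-δ (ρ r) Mᵢⱼ)) ⟩
  combination (M ∘ ρ) y j                               ∎)
  where
    open ≡-Reasoning
    Mᵢⱼ = λ i → toℕ (M i j)

weight≡supportSize : ∀ {p n} (v : Vec𝔽 p n) → weight v ≡ supportSize (toℕ ∘ v)
weight≡supportSize {n = zero}  v = refl
weight≡supportSize {n = suc n} v with toℕ (v fzero)
... | zero  = weight≡supportSize (tail v)
... | suc _ = cong suc (weight≡supportSize (tail v))

weight-cong : ∀ {p n} {u u′ : Vec𝔽 p n} → (∀ j → u j ≡ u′ j) → weight u ≡ weight u′
weight-cong {u = u} {u′} u≗u′ = begin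
  weight u                 ≡⟨ weight≡supportSize u ⟩
  supportSize (toℕ ∘ u)    ≡⟨ sum-cong-≗ (cong (χ≢0 ∘ toℕ) ∘ u≗u′) ⟩
  supportSize (toℕ ∘ u′)   ≡⟨ weight≡supportSize u′ ⟨
  weight u′                ∎
  where open ≡-Reasoning

zeroCount+weight : ∀ {p n} (v : Vec𝔽 p n) → zeroCount (toℕ ∘ v) + weight v ≡ n
zeroCount+weight v = trans (cong (zeroCount (toℕ ∘ v) +_) (weight≡supportSize v)) (zeroCount+supportSize (toℕ ∘ v))

zeroCount≡∸weight : ∀ {p n} (v : Vec𝔽 p n) → zeroCount (toℕ ∘ v) ≡ n ∸ weight v
zeroCount≡∸weight v = trans (sym (m+n∸n≡m _ (weight v))) (cong (_∸ weight v) (zeroCount+weight v))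

weight<⇒0<zeroCount : ∀ {p n} (v : Vec𝔽 p n) → weight v < n → 0 < zeroCount (toℕ ∘ v)
weight<⇒0<zeroCount v k<n = +-cancelʳ-< (weight v) 0 _ (subst (weight v <_) (sym (zeroCount+weight v)) k<n)

module _ {p : ℕ} .{{_ : NonZero p}} where

  %-cong-+ : ∀ {a b c d} → a % p ≡ b % p → c % p ≡ d % p → (a + c) % p ≡ (b + d) % p
  %-cong-+ {a} {b} {c} {d} a≡b c≡d = begin
    (a + c) % p              ≡⟨ %-distribˡ-+ a c p ⟩
    (a % p + c % p) % p      ≡⟨ cong₂ (λ x y → (x + y) % p) a≡b c≡d ⟩
    (b % p + d % p) % p      ≡⟨ %-distribˡ-+ b d p ⟨
    (b + d) % p              ∎
    where open ≡-Reasoning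

  %-cong-* : ∀ {a b c d} → a % p ≡ b % p → c % p ≡ d % p → (a * c) % p ≡ (b * d) % p
  %-cong-* {a} {b} {c} {d} a≡b c≡d = begin
    (a * c) % p              ≡⟨ %-distribˡ-* a c p ⟩
    (a % p * (c % p)) % p    ≡⟨ cong₂ (λ x y → (x * y) % p) a≡b c≡d ⟩
    (b % p * (d % p)) % p    ≡⟨ %-distribˡ-* b d p ⟨
    (b * d) % p              ∎
    where open ≡-Reasoning

  toℕ-mod : ∀ a → toℕ (a mod p) ≡ a % p
  toℕ-mod a = toℕ-fromℕ< (m%n<n a p)

  mod-cong : ∀ {a b} → a % p ≡ b % p → a mod p ≡ b mod p
  mod-cong a≡b = toℕ-injective (trans (toℕ-mod _) (trans a≡b (sym (toℕ-mod _))))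

  ∑-%-* : ∀ {m} (x y : Fin m → ℕ) → (∑[ i < m ] (x i % p * y i)) % p ≡ (∑[ i < m ] (x i * y i)) % p
  ∑-%-* {zero}  x y = refl
  ∑-%-* {suc m} x y = %-cong-+ (%-cong-* (m%n%n≡m%n (x fzero) p) refl) (∑-%-* (tail x) (tail y))

  rowVector : ∀ {m n} → Mat𝔽 p m n → (Fin m → ℕ) → Vec𝔽 p n
  rowVector M x j = combination M x j mod p

  rowVector-InRow : ∀ {m n} (M : Mat𝔽 p m n) x → InRow M (rowVector M x)
  rowVector-InRow {m} M x = (λ i → x i mod p) , λ j → begin
    combination M x j mod p                                     ≡⟨ mod-cong (∑-%-* x (λ i → toℕ (M i j))) ⟨
    combination M (λ i → x i % p) j mod p                       ≡⟨ cong (_mod p) (sum-cong-≗ (λ i → cong (_* toℕ (M i j)) (toℕ-mod (x i)))) ⟨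
    combination M (λ i → toℕ (x i mod p)) j mod p               ≡⟨ cong (_mod p) (sumFin≡sum m _) ⟨
    sumFin m (λ i → toℕ (x i mod p) * toℕ (M i j)) mod p        ∎
    where open ≡-Reasoning

  InRow⇒rowVector : ∀ {m n} {M : Mat𝔽 p m n} {v} (v∈M : InRow M v) → ∀ j → v j ≡ rowVector M (toℕ ∘ proj₁ v∈M) j
  InRow⇒rowVector {m} (a , v≡) j = trans (v≡ j) (cong (_mod p) (sumFin≡sum m _))

  InRow-cong : ∀ {m n} {M : Mat𝔽 p m n} {u u′} → (∀ j → u j ≡ u′ j) → InRow M u → InRow M u′
  InRow-cong u≗u′ (a , u≡) = a , λ j → trans (sym (u≗u′ j)) (u≡ j)

  InRow-selectRows : ∀ {k m n} {M : Mat𝔽 p m n} (ρ : Fin k → Fin m) {u} → InRow (M ∘ ρ) u → InRow M u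
  InRow-selectRows {k} {M = M} ρ u∈ = InRow-cong u≗ (rowVector-InRow M (λ i → ∑[ r < k ] (y r * δ (ρ r) i)))
    where
      y = toℕ ∘ proj₁ u∈
      u≗ = λ j → sym (trans (InRow⇒rowVector u∈ j) (cong (_mod p) (combination-selectRows M ρ y j)))

  InRow-extendColumns : ∀ {m n N} {M : Mat𝔽 p m n} (σ : Fin N → Fin n) {u} →
    InRow (λ i s → M i (σ s)) u → ∃ λ w → InRow M w × (∀ s → w (σ s) ≡ u s)
  InRow-extendColumns {M = M} σ u∈ =
    rowVector M x , rowVector-InRow M x , λ s → sym (InRow⇒rowVector u∈ s)
    where x = toℕ ∘ proj₁ u∈

  line : ∀ {n} → Vec𝔽 p n → Vec𝔽 p n → Fin p → Vec𝔽 p n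
  line v w t j = (toℕ t * toℕ (v j) + toℕ (w j)) mod p

  InRow-line : ∀ {m n} {M : Mat𝔽 p m n} {v w} → InRow M v → InRow M w → ∀ t → InRow M (line v w t)
  InRow-line {M = M} {v} {w} v∈ w∈ t = InRow-cong z≗ (rowVector-InRow M (λ i → toℕ t * x i + y i))
    where
      x = toℕ ∘ proj₁ v∈
      y = toℕ ∘ proj₁ w∈
      toℕ-entry : ∀ {u} (u∈ : InRow M u) j → toℕ (u j) ≡ combination M (toℕ ∘ proj₁ u∈) j % p
      toℕ-entry u∈ j = trans (cong toℕ (InRow⇒rowVector u∈ j)) (toℕ-mod _)
      z≗ : ∀ j → rowVector M (λ i → toℕ t * x i + y i) j ≡ line v w t j
      z≗ j = mod-cong (begin
        combination M (λ i → toℕ t * x i + y i) j % p                  ≡⟨ cong (_% p) (combination-linear M (toℕ t) x y j) ⟩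
        (toℕ t * combination M x j + combination M y j) % p            ≡⟨ %-cong-+ (%-cong-* {toℕ t} refl (m%n%n≡m%n _ p)) (m%n%n≡m%n _ p) ⟨
        (toℕ t * (combination M x j % p) + combination M y j % p) % p  ≡⟨ cong₂ (λ a b → (toℕ t * a + b) % p) (toℕ-entry v∈ j) (toℕ-entry w∈ j) ⟨
        (toℕ t * toℕ (v j) + toℕ (w j)) % p                            ∎)
        where open ≡-Reasoning

  capacity-exists : ∀ {m n} (M : Mat𝔽 p m n) → ∃ (IsCapacity M)
  capacity-exists {m} M = f a* , (rowVector M (toℕ ∘ a*) , rowVector-InRow M (toℕ ∘ a*) , refl) , bound
    where
      f : (Fin m → Fin p) → ℕ
      f a = weight (rowVector M (toℕ ∘ a))
      f-cong : ∀ {a b} → (∀ i → a i ≡ b i) → f a ≡ f b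
      f-cong a≗b = weight-cong (λ j → cong (_mod p) (sum-cong-≗ (λ i → cong (λ c → toℕ c * toℕ (M i j)) (a≗b i))))
      a*  = argmax-→ m f f-cong .proj₁
      bound : ∀ v → InRow M v → weight v ≤ f a*
      bound v v∈ = ≤-trans (≤-reflexive (weight-cong (InRow⇒rowVector v∈))) (argmax-→ m f f-cong .proj₂ (proj₁ v∈))

  IsLambda⇒heavyRowVector : ∀ {k l m} {M : Mat𝔽 p m k} → IsLambda p k l → InMStar M → ∃ λ u → InRow M u × l ≤ weight u
  IsLambda⇒heavyRowVector {M = M} (_ , l≤capacity) M* with capacity-exists M
  ... | c , cap@((u , u∈ , wu≡c) , _) = u , u∈ , ≤-trans (l≤capacity _ M M* c cap) (≤-reflexive (sym wu≡c))

  InMStar-submatrix : ∀ {m n N} {M : Mat𝔽 p m n} → 1 < p → InMStar M → (σ : Fin N → Fin n) → 1 ≤ N →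
    Σ (Fin N → Fin m) λ ρ → InMStar {p} (λ r s → M (ρ r) (σ s))
  -- Row r is chosen nonzero in column σ r, so the submatrix has a nonzero diagonal.
  InMStar-submatrix 1<p (_ , _ , nonzeroColumn) σ 1≤N =
    (λ r → proj₁ (nonzeroColumn (σ r))) , 1≤N , <⇒≤ (n<m^n 1<p _) , λ s → s , proj₂ (nonzeroColumn (σ s))

  IsLambda⇒heavyOnColumns : ∀ {m n N l} {M : Mat𝔽 p m n} → 1 < p → InMStar M → (σ : Fin N → Fin n) → 1 ≤ N →
    IsLambda p N l → ∃ λ w → InRow M w × l ≤ weight (w ∘ σ)
  IsLambda⇒heavyOnColumns 1<p M* σ 1≤N isλ with InMStar-submatrix 1<p M* σ 1≤N
  ... | ρ , M′* with IsLambda⇒heavyRowVector isλ M′*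
  ... | u , u∈ , l≤wu with InRow-extendColumns σ u∈
  ... | w , w∈ , w∘σ≗u = w , InRow-selectRows ρ w∈ , ≤-trans l≤wu (≤-reflexive (weight-cong (sym ∘ w∘σ≗u)))

  line-off-support : ∀ {n} (v w : Vec𝔽 p n) t j → toℕ (v j) ≡ 0 → line v w t j ≡ w j
  line-off-support v w t j vⱼ≡0 = toℕ-injective (begin
    toℕ (line v w t j)                    ≡⟨ toℕ-mod _ ⟩
    (toℕ t * toℕ (v j) + toℕ (w j)) % p   ≡⟨ cong (λ y → (toℕ t * y + toℕ (w j)) % p) vⱼ≡0 ⟩
    (toℕ t * 0 + toℕ (w j)) % p           ≡⟨ cong (λ y → (y + toℕ (w j)) % p) (*-zeroʳ (toℕ t)) ⟩
    toℕ (w j) % p                         ≡⟨ m<n⇒m%n≡m (toℕ<n (w j)) ⟩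
    toℕ (w j)                             ∎)
    where open ≡-Reasoning

  weight-line : ∀ {n} (v w : Vec𝔽 p n) t →
    weight (line v w t) + zerosOnSupport (toℕ ∘ v) (toℕ ∘ line v w t) ≡ weight v + weight (w ∘ zeroIndex (toℕ ∘ v))
  weight-line v w t = begin
    weight (line v w t) + zerosOnSupport x (toℕ ∘ line v w t)             ≡⟨ cong (_+ zerosOnSupport x (toℕ ∘ line v w t)) (weight≡supportSize (line v w t)) ⟩
    supportSize (toℕ ∘ line v w t) + zerosOnSupport x (toℕ ∘ line v w t)  ≡⟨ supportSize-split x (toℕ ∘ line v w t) ⟩
    supportSize x + supportSize (toℕ ∘ line v w t ∘ σ)                     ≡⟨ cong₂ _+_ (weight≡supportSize v) (weight≡supportSize (line v w t ∘ σ)) ⟨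
    weight v + weight (line v w t ∘ σ)                                     ≡⟨ cong (weight v +_) (weight-cong (λ r → line-off-support v w t (σ r) (zeroIndex-zero x r))) ⟩
    weight v + weight (w ∘ σ)                                              ∎
    where
      open ≡-Reasoning
      x = toℕ ∘ v
      σ = zeroIndex x

  ∑-zerosOnSupport-line≤weight : ∀ {n} → Prime p → (v w : Vec𝔽 p n) →
    ∑[ t < p ] zerosOnSupport (toℕ ∘ v) (toℕ ∘ line v w t) ≤ weight v
  ∑-zerosOnSupport-line≤weight p-prime v w =
    ≤-trans (∑-zerosOnSupport≤supportSize (toℕ ∘ v) (λ t → toℕ ∘ line v w t) unique) (≤-reflexive (sym (weight≡supportSize v)))
    where
      p∣ : ∀ t j → toℕ (line v w t j) ≡ 0 → p ∣ toℕ t * toℕ (v j) + toℕ (w j)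
      p∣ t j ≡0 = m%n≡0⇒n∣m _ p (trans (sym (toℕ-mod _)) ≡0)
      unique : ∀ j → 0 < toℕ (v j) → ∀ t t′ → toℕ (line v w t j) ≡ 0 → toℕ (line v w t′ j) ≡ 0 → t ≡ t′
      unique j 0<vⱼ t t′ ≡0 ≡0′ = affine-root-unique p-prime 0<vⱼ (toℕ<n (v j)) t t′ (p∣ t j ≡0) (p∣ t′ j ≡0′)

  ∃-line-heavier : ∀ {n l} → Prime p → (v w : Vec𝔽 p n) →
    l ≤ weight (w ∘ zeroIndex (toℕ ∘ v)) → weight v < p * l → ∃ λ t → weight v < weight (line v w t)
  ∃-line-heavier {l = l} p-prime v w l≤ k<pl
    with ∑<*⇒∃< (λ t → zerosOnSupport (toℕ ∘ v) (toℕ ∘ line v w t)) l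
                (≤-<-trans (∑-zerosOnSupport-line≤weight p-prime v w) k<pl)
  ... | t , few = t , +-cancelʳ-< l (weight v) _ (begin-strict
    weight v + l                                                       ≤⟨ +-monoʳ-≤ (weight v) l≤ ⟩
    weight v + weight (w ∘ zeroIndex (toℕ ∘ v))                        ≡⟨ weight-line v w t ⟨
    weight (line v w t) + zerosOnSupport (toℕ ∘ v) (toℕ ∘ line v w t)  <⟨ +-monoʳ-< (weight (line v w t)) few ⟩
    weight (line v w t) + l                                            ∎)
    where open ≤-Reasoning

lemma2p1 : (p : ℕ) .{{_ : NonZero p}} → Prime p → (n : ℕ) → 1 ≤ n →
    (m : ℕ) (M : Mat𝔽 p m n) → InMStar M →
    (v : Vec𝔽 p n) → InRow M v → 0 < weight v → weight v < n →
    (Σ ℕ λ l → IsLambda p (n ∸ weight v) l × weight v < p * l) →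
    Σ (Vec𝔽 p n) λ z → InRow M z × 0 < weight z × weight v < weight z
lemma2p1 p p-prime n _ m M M* v v∈ _ k<n (l , isλ , k<pl)
  with IsLambda⇒heavyOnColumns (nonTrivial⇒n>1 p {{prime⇒nonTrivial p-prime}}) M* (zeroIndex (toℕ ∘ v))
         (weight<⇒0<zeroCount v k<n) (subst (λ N → IsLambda p N l) (sym (zeroCount≡∸weight v)) isλ)
... | w , w∈ , l≤ with ∃-line-heavier p-prime v w l≤ k<pl
... | t , k<weight = line v w t , InRow-line v∈ w∈ t , ≤-<-trans z≤n k<weight , k<weight
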